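{- Let $G$ be a connected graph and let $A, B$ be two disjoint, linked and saturated subsets of $V(G)$. If $u, v \in V(G)\setminus(A\cup B)$ satisfy $\{u,v\} \in \mathrm{mfs}(A,B)$ and $u \equiv_{AB} v$, then $A$ and $B$ are not separable.
   Context: All graphs are finite, undirected and loopless. For $X \subseteq V(G)$, $N(X) = \{w \in V(G)\setminus X : w \text{ adjacent to some } x\in X\}$, $N[X] = N(X)\cup X$, and $G-X$ is the subgraph induced by $V(G)\setminus X$. A chordless $xy$-path is an $xy$-path that is an induced subgraph. A set $C$ is convex if for all $x,y\in C$ every vertex on a chordless $xy$-path lies in $C$; $\mathrm{cl}(X)$ is the intersection of all convex sets containing $X$. A half-space is a convex set $H$ with $V(G)\setminus H$ convex; $A,B$ are separable if some half-space $H$ satisfies $A\subseteq H$ and $B\subseteq V(G)\setminus H$. $A,B$ are linked if some vertex of $A$ is adjacent to some vertex of $B$. $A/B = \{w : \mathrm{cl}(B\cup\{w\})\cap A\ne\emptyset\}$. A set $X \subseteq V(G)\setminus(A\cup B)$ is forbidden if $\mathrm{cl}(X)$ meets both $A$ and $B$; $\mathrm{mfs}(A,B)$ is the family of inclusion-minimal forbidden sets. $\sigma(A,B) = \mathrm{cl}\big(A/B\cup\bigcup\{\bigcap_{x\in X}\mathrm{cl}(A\cup\{x\}) : X\in\mathrm{mfs}(A,B)\}\big)$; $S(A,B) = \bigcup_{i\ge0}\sigma(A_i,B_i)$ with $A_0=A$, $B_0=B$, $A_i=\sigma(A_{i-1},B_{i-1})$, $B_i=\sigma(B_{i-1},A_{i-1})$;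 $A,B$ are saturated if $A=S(A,B)$ and $B=S(B,A)$. An intersecting sequence is a sequence $S_1,\dots,S_k$ of (not necessarily distinct) connected components of $G-N[A\cup B]$ with $N(S_i)\cap N(S_{i+1})\ne\emptyset$ for $1\le i<k$; vertices $x,y$ belong to it if $x\in N[S_i]$, $y\in N[S_j]$ for some $i,j$. For $x,y \in V(G)\setminus(A\cup B)$, $x\equiv_{AB} y$ iff $x=y$ or $x,y$ belong to a common intersecting sequence. -}

module Defs where

open import Data.Nat using (ℕ; zero; suc)
open import Data.Fin using (Fin; toℕ; fromℕ; inject₁) renaming (zero to fzero; suc to fsuc)
open import Data.Fin.Subset using (Subset; _∈_; _∉_)
open import Data.Product using (Σ; ∃; ∃-syntax; _×_; _,_; proj₁; proj₂)
open import Data.Sum using (_⊎_)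
open import Data.Empty using (⊥)
open import Relation.Nullary using (¬_)
open import Relation.Binary.PropositionalEquality using (_≡_)
open import Relation.Unary using (Pred)
open import Function.Definitions using (Injective)
open import Level using (0ℓ)

record Graph (n : ℕ) : Set₁ where
  field
    Adj     : Fin n → Fin n → Set
    sym     : ∀ {x y} → Adj x y → Adj y x
    irrefl  : ∀ {x} → ¬ Adj x x

-- Vertex sets: derived sets are predicates on Fin n; sets quantified over
-- (convex sets, half-spaces, forbidden sets, components) are finite subsets Subset n.
VSet : ℕ → Set₁
VSet n = Pred (Fin n) 0ℓ

⟦_⟧ : ∀ {n} → Subset n → VSet n
⟦ X ⟧ v = v ∈ X

_⊆_ : ∀ {n} → VSet n → VSet n → Set
X ⊆ Y = ∀ v → X v → Y v

_≐_ : ∀ {n} → VSet n → VSet n → Set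
X ≐ Y = (X ⊆ Y) × (Y ⊆ X)

_∪_ : ∀ {n} → VSet n → VSet n → VSet n
(X ∪ Y) v = X v ⊎ Y v

｛_｝ : ∀ {n} → Fin n → VSet n
｛ x ｝ v = v ≡ x

Disjoint : ∀ {n} → VSet n → VSet n → Set
Disjoint X Y = ∀ v → X v → Y v → ⊥

module _ {n : ℕ} (G : Graph n) where
  open Graph G

  lastF : (k : ℕ) → Fin (suc k)
  lastF k = fromℕ k

  IsWalk : Fin n → Fin n → (k : ℕ) → (Fin (suc k) → Fin n) → Set
  IsWalk x y k p = (p fzero ≡ x) × (p (lastF k) ≡ y)
                   × (∀ (i : Fin k) → Adj (p (inject₁ i)) (p (fsuc i)))

  Connected : Set
  Connected = ∀ x y → ∃[ k ] Σ (Fin (suc k) → Fin n) (IsWalk x y k)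

  IsChordlessPath : Fin n → Fin n → (k : ℕ) → (Fin (suc k) → Fin n) → Set
  IsChordlessPath x y k p =
    (p fzero ≡ x) × (p (lastF k) ≡ y) × Injective _≡_ _≡_ p
    × (∀ i j → (Adj (p i) (p j) → (toℕ j ≡ suc (toℕ i) ⊎ toℕ i ≡ suc (toℕ j)))
             × ((toℕ j ≡ suc (toℕ i) ⊎ toℕ i ≡ suc (toℕ j)) → Adj (p i) (p j)))

  Convex : VSet n → Set
  Convex C = ∀ x y k p → IsChordlessPath x y k p → C x → C y → ∀ i → C (p i)

  cl : VSet n → VSet n
  cl X v = ∀ (C : Subset n) → Convex ⟦ C ⟧ → X ⊆ ⟦ C ⟧ → v ∈ C

  HalfSpace : Subset n → Set
  HalfSpace H = Convex ⟦ H ⟧ × Convex (λ v → v ∉ H)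

  Separable : VSet n → VSet n → Set
  Separable A B = Σ (Subset n) λ H → HalfSpace H × (A ⊆ ⟦ H ⟧) × (B ⊆ (λ v → v ∉ H))

  Linked : VSet n → VSet n → Set
  Linked A B = ∃[ a ] ∃[ b ] A a × B b × Adj a b

  N : VSet n → VSet n
  N X w = ¬ X w × ∃[ x ] X x × Adj w x

  N[_] : VSet n → VSet n
  N[ X ] = X ∪ N X

  _/_ : VSet n → VSet n → VSet n
  (A / B) w = ∃[ a ] A a × cl (B ∪ ｛ w ｝) a

  Forbidden : VSet n → VSet n → Subset n → Set
  Forbidden A B X = (∀ v → v ∈ X → ¬ (A ∪ B) v)
                    × (∃[ a ] A a × cl ⟦ X ⟧ a) × (∃[ b ] B b × cl ⟦ X ⟧ b)

  MFS : VSet n → VSet n → Subset n → Set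
  MFS A B X = Forbidden A B X
              × (∀ (Y : Subset n) → ⟦ Y ⟧ ⊆ ⟦ X ⟧ → Forbidden A B Y → ⟦ X ⟧ ⊆ ⟦ Y ⟧)

  σ : VSet n → VSet n → VSet n
  σ A B = cl (λ w → (A / B) w
                    ⊎ (∃[ X ] MFS A B X × (∀ x → x ∈ X → cl (A ∪ ｛ x ｝) w)))

  iter : VSet n → VSet n → ℕ → VSet n × VSet n
  iter A B zero = A , B
  iter A B (suc i) = let p = iter A B i in σ (proj₁ p) (proj₂ p) , σ (proj₂ p) (proj₁ p)

  S : VSet n → VSet n → VSet n
  S A B v = ∃[ i ] σ (proj₁ (iter A B i)) (proj₂ (iter A B i)) v

  Saturated : VSet n → VSet n → Set
  Saturated A B = (A ≐ S A B) × (B ≐ S B A)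

  Outside : VSet n → VSet n → VSet n
  Outside A B v = ¬ N[ A ∪ B ] v

  IsComponent : VSet n → VSet n → Subset n → Set
  IsComponent A B K =
    (∃[ v ] v ∈ K)
    × (∀ v → v ∈ K → Outside A B v)
    × (∀ x y → x ∈ K → y ∈ K → ∃[ k ] Σ (Fin (suc k) → Fin n) λ p →
          IsWalk x y k p × (∀ i → p i ∈ K))
    × (∀ x y → x ∈ K → Outside A B y → Adj x y → y ∈ K)

  IntersectingSeq : VSet n → VSet n → (k : ℕ) → (Fin (suc k) → Subset n) → Set
  IntersectingSeq A B k Ss =
    (∀ i → IsComponent A B (Ss i))
    × (∀ (i : Fin k) → ∃[ w ] N ⟦ Ss (inject₁ i) ⟧ w × N ⟦ Ss (fsuc i) ⟧ w)

  BelongTo : (k : ℕ) → (Fin (suc k) → Subset n) → Fin n → Fin n → Set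
  BelongTo k Ss x y = (∃[ i ] N[ ⟦ Ss i ⟧ ] x) × (∃[ j ] N[ ⟦ Ss j ⟧ ] y)

  EquivAB : VSet n → VSet n → Fin n → Fin n → Set
  EquivAB A B x y = ¬ (A ∪ B) x × ¬ (A ∪ B) y
    × (x ≡ y ⊎ (∃[ k ] Σ (Fin (suc k) → Subset n) λ Ss →
                  IntersectingSeq A B k Ss × BelongTo k Ss x y))

{-# OPTIONS --safe #-}
module Submission where

-- Suppose a half-space H separates A from B, and let ab be an edge with a ∈ A ⊆ H and b ∈ B
-- outside H. For every component K of G − N[A ∪ B], N[K] lies on one side of H: if y ∈ K
-- and x ∈ N[K] were on different sides, walk from y through K to x, then inside x's side
-- (convex sets of a connected graph are connected) to the end of ab on that side, and across
-- ab. The chordless subpath from y to the far end of ab stays on y's side by convexity, so its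
-- penultimate vertex lies in K and is adjacent to a vertex of A ∪ B, which is impossible.
-- Chaining along an intersecting sequence puts u and v on one side of H; that side is convex,
-- so it contains cl{u, v}, which meets both A and B.

open import Defs hiding (_∪_)
open import Data.Nat using (ℕ)
open import Data.Fin using (Fin)
open import Data.Fin.Subset using (Subset; ⁅_⁆; _∪_)
open import Relation.Nullary using (¬_)

open import Defs using () renaming (_∪_ to _∪ᵥ_)
open import Data.Nat using (zero; suc; _≤_; _<_; _≤?_; z≤n; s≤s; s≤s⁻¹)
open import Data.Nat.Properties
  using (≤-refl; ≤-trans; <-≤-trans; <⇒≤; n≤1+n; n≤0⇒n≡0; <-irrefl; m≤n⇒m<n∨m≡n; m<1+n⇒m≤n)
open import Data.Fin using (toℕ; fromℕ; fromℕ<; inject₁; _≟_) renaming (zero to fzero; suc to fsuc)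
open import Data.Fin.Properties using (toℕ-fromℕ; toℕ-fromℕ<; toℕ-injective; toℕ≤pred[n])
open import Data.Fin.Subset using (_∈_; _∉_; ∁)
open import Data.Fin.Subset.Properties using (_∈?_; x∈⁅y⁆⇒x≡y; x∈p∪q⁻; x∈∁p⇒x∉p; x∉p⇒x∈∁p; x∉∁p⇒x∈p)
open import Data.Product using (∃-syntax; _×_; _,_; proj₁; proj₂)
open import Data.Sum using (_⊎_; inj₁; inj₂; [_,_]′)
open import Data.Empty using (⊥-elim)
open import Function using (_∘_; flip; _⇔_; mk⇔; Equivalence)
open import Function.Properties.Equivalence using ()
  renaming (refl to ⇔-refl; sym to ⇔-sym; trans to ⇔-trans)
open import Relation.Nullary using (Dec; yes; no)
open import Relation.Nullary.Decidable using (_⊎-dec_)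
open import Relation.Unary using (U)
open import Relation.Binary.Definitions using (Decidable)
open import Relation.Binary.PropositionalEquality
  using (_≡_; _≢_; refl; sym; trans; subst; subst₂; cong)

¬¬-∀-Fin : ∀ {m} {Q : Fin m → Set} → (∀ i → ¬ ¬ Q i) → ¬ ¬ (∀ i → Q i)
¬¬-∀-Fin {zero}  _   ¬all = ¬all (λ ())
¬¬-∀-Fin {suc m} ¬¬Q ¬all =
  ¬¬Q fzero λ q₀ → ¬¬-∀-Fin (¬¬Q ∘ fsuc) λ qs → ¬all λ { fzero → q₀ ; (fsuc i) → qs i }

¬¬-decidable : ∀ {m} (R : Fin m → Fin m → Set) → ¬ ¬ Decidable R
¬¬-decidable R = ¬¬-∀-Fin λ x → ¬¬-∀-Fin λ y ¬dec → ¬dec (no λ r → ¬dec (yes r))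

least : ∀ {Q : ℕ → Set} → (∀ i → Dec (Q i)) → ∀ {k} → Q k
      → ∃[ i ] i ≤ k × Q i × (∀ {j} → j < i → ¬ Q j)
least Q? {zero} q = 0 , z≤n , q , λ ()
least Q? {suc k} q with Q? 0
... | yes q₀ = 0 , z≤n , q₀ , λ ()
... | no ¬q₀ with least (Q? ∘ suc) q
...   | i , i≤k , qᵢ , below =
  suc i , s≤s i≤k , qᵢ , λ { {zero} _ → ¬q₀ ; {suc j} j<i → below (s≤s⁻¹ j<i) }

⁅u⁆∪⁅v⁆⊆ : ∀ {n} {u v : Fin n} {S : Subset n} → u ∈ S → v ∈ S → ⟦ ⁅ u ⁆ ∪ ⁅ v ⁆ ⟧ ⊆ ⟦ S ⟧
⁅u⁆∪⁅v⁆⊆ {u = u} {v} {S} uS vS x x∈ =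
  [ (λ x∈⁅u⁆ → subst (_∈ S) (sym (x∈⁅y⁆⇒x≡y u x∈⁅u⁆)) uS)
  , (λ x∈⁅v⁆ → subst (_∈ S) (sym (x∈⁅y⁆⇒x≡y v x∈⁅v⁆)) vS) ]′ (x∈p∪q⁻ ⁅ u ⁆ ⁅ v ⁆ x∈)

same-side⇒pair-on-one-side : ∀ {n} {H : Subset n} {u v} → (u ∈ H ⇔ v ∈ H)
                           → ⟦ ⁅ u ⁆ ∪ ⁅ v ⁆ ⟧ ⊆ ⟦ H ⟧ ⊎ ⟦ ⁅ u ⁆ ∪ ⁅ v ⁆ ⟧ ⊆ ⟦ ∁ H ⟧
same-side⇒pair-on-one-side {H = H} {u} u⇔v with u ∈? H
... | yes u∈H = inj₁ (⁅u⁆∪⁅v⁆⊆ u∈H (Equivalence.to u⇔v u∈H))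
... | no  u∉H = inj₂ (⁅u⁆∪⁅v⁆⊆ (x∉p⇒x∈∁p u∉H) (x∉p⇒x∈∁p (u∉H ∘ Equivalence.from u⇔v)))

module _ {n : ℕ} (G : Graph n) where
  open Graph G using (Adj; irrefl) renaming (sym to Adj-sym)

  Convex-resp-≐ : ∀ {C D} → C ≐ D → Convex G C → Convex G D
  Convex-resp-≐ (C⊆D , D⊆C) convex x y k p path Dx Dy i =
    C⊆D _ (convex x y k p path (D⊆C _ Dx) (D⊆C _ Dy) i)

  HalfSpace⇒Convex-∁ : ∀ {H} → HalfSpace G H → Convex G ⟦ ∁ H ⟧
  HalfSpace⇒Convex-∁ (_ , convex-∉) = Convex-resp-≐ ((λ _ → x∉p⇒x∈∁p) , (λ _ → x∈∁p⇒x∉p)) convex-∉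

  one-side-not-forbidden : ∀ {A B H X} → HalfSpace G H → A ⊆ ⟦ H ⟧ → B ⊆ (_∉ H)
                         → ⟦ X ⟧ ⊆ ⟦ H ⟧ ⊎ ⟦ X ⟧ ⊆ ⟦ ∁ H ⟧ → ¬ Forbidden G A B X
  one-side-not-forbidden half _ B∌H (inj₁ X⊆H) (_ , _ , b , Bb , b∈clX) =
    B∌H b Bb (b∈clX _ (proj₁ half) X⊆H)
  one-side-not-forbidden half A⊆H _ (inj₂ X⊆∁H) (_ , (a , Aa , a∈clX) , _) =
    x∈∁p⇒x∉p (a∈clX _ (HalfSpace⇒Convex-∁ half) X⊆∁H) (A⊆H a Aa)

  Outside⇒¬Adj : ∀ {A B w b} → Outside G A B w → (A ∪ᵥ B) b → ¬ Adj w b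
  Outside⇒¬Adj out ABb wb = out (inj₂ (out ∘ inj₁ , _ , ABb , wb))

  data WalkIn (P : VSet n) (x : Fin n) : Fin n → Set where
    stay : P x → WalkIn P x x
    step : ∀ {y z} → WalkIn P x y → Adj y z → P z → WalkIn P x z

  WalkIn-source : ∀ {P x y} → WalkIn P x y → P x
  WalkIn-source (stay Px)    = Px
  WalkIn-source (step w _ _) = WalkIn-source w

  WalkIn-map : ∀ {P Q x y} → P ⊆ Q → WalkIn P x y → WalkIn Q x y
  WalkIn-map P⊆Q (stay Px)       = stay (P⊆Q _ Px)
  WalkIn-map P⊆Q (step w yz Pz)  = step (WalkIn-map P⊆Q w) yz (P⊆Q _ Pz)

  _++ʷ_ : ∀ {P x y z} → WalkIn P x y → WalkIn P y z → WalkIn P x z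
  w ++ʷ stay _          = w
  w ++ʷ step w′ yz Pz   = step (w ++ʷ w′) yz Pz

  IsWalk⇒WalkIn : ∀ {P x y} k p → IsWalk G x y k p → (∀ i → P (p i)) → WalkIn P x y
  IsWalk⇒WalkIn zero    p (refl , refl , _)     inP = stay (inP fzero)
  IsWalk⇒WalkIn (suc k) p (refl , refl , edges) inP =
    step (IsWalk⇒WalkIn k (p ∘ inject₁) (refl , refl , edges ∘ inject₁) (inP ∘ inject₁))
         (edges (fromℕ k)) (inP (fromℕ (suc k)))

  component-walk : ∀ {A B K x y} → IsComponent G A B K → x ∈ K → y ∈ K → WalkIn ⟦ K ⟧ x y
  component-walk (_ , _ , walks , _) xK yK with walks _ _ xK yK
  ... | k , p , walk , inK = IsWalk⇒WalkIn k p walk inK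

  -- Vertices are indexed by ℕ to keep index arithmetic out of Fin; indices beyond k are junk.
  record ChordlessPath (P : VSet n) (x y : Fin n) (k : ℕ) : Set where
    field
      vertex    : ℕ → Fin n
      start     : vertex 0 ≡ x
      end       : vertex k ≡ y
      injective : ∀ {i j} → i ≤ k → j ≤ k → vertex i ≡ vertex j → i ≡ j
      edge      : ∀ {i} → i < k → Adj (vertex i) (vertex (suc i))
      chordless : ∀ {i j} → i ≤ k → j ≤ k → Adj (vertex i) (vertex j) → j ≡ suc i ⊎ i ≡ suc j
      inside    : ∀ {i} → i ≤ k → P (vertex i)

  open ChordlessPath

  consecutive⇒Adj : ∀ {P x y k} (c : ChordlessPath P x y k) {i j} → i ≤ k → j ≤ k
                  → j ≡ suc i ⊎ i ≡ suc j → Adj (vertex c i) (vertex c j)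
  consecutive⇒Adj c _   j≤k (inj₁ refl) = edge c j≤k
  consecutive⇒Adj c i≤k _   (inj₂ refl) = Adj-sym (edge c i≤k)

  isChordlessPath : ∀ {P x y k} (c : ChordlessPath P x y k)
                  → IsChordlessPath G x y k (vertex c ∘ toℕ)
  isChordlessPath {k = k} c =
      start c
    , trans (cong (vertex c) (toℕ-fromℕ k)) (end c)
    , (λ e → toℕ-injective (injective c (toℕ≤pred[n] _) (toℕ≤pred[n] _) e))
    , λ i j → chordless c (toℕ≤pred[n] i) (toℕ≤pred[n] j)
            , consecutive⇒Adj c (toℕ≤pred[n] i) (toℕ≤pred[n] j)

  Convex⇒vertices : ∀ {C P x y k} → Convex G C → (c : ChordlessPath P x y k) → C x → C y
                  → ∀ {i} → i ≤ k → C (vertex c i)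
  Convex⇒vertices {C} {k = k} convex c Cx Cy i≤k =
    subst (C ∘ vertex c) (toℕ-fromℕ< (s≤s i≤k))
      (convex _ _ k _ (isChordlessPath c) Cx Cy (fromℕ< (s≤s i≤k)))

  restrict : ∀ {C P x y k} → Convex G C → C x → C y → ChordlessPath P x y k → ChordlessPath C x y k
  restrict convex Cx Cy c = record
    { vertex    = vertex c
    ; start     = start c
    ; end       = end c
    ; injective = injective c
    ; edge      = edge c
    ; chordless = chordless c
    ; inside    = Convex⇒vertices convex c Cx Cy
    }

  ChordlessPath⇒WalkIn : ∀ {P x y k} → ChordlessPath P x y k → WalkIn P x y
  ChordlessPath⇒WalkIn {P} {x} {k = k} c = subst (WalkIn P x) (end c) (upTo k ≤-refl)
    where
    upTo : ∀ i → i ≤ k → WalkIn P x (vertex c i)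
    upTo zero    _   = subst (WalkIn P x) (sym (start c)) (stay (subst P (start c) (inside c z≤n)))
    upTo (suc i) i<k = step (upTo i (<⇒≤ i<k)) (edge c i<k) (inside c i<k)

  singleton : ∀ {P x} → P x → ChordlessPath P x x 0
  singleton {x = x} Px = record
    { vertex    = λ _ → x
    ; start     = refl
    ; end       = refl
    ; injective = λ i≤0 j≤0 _ → trans (n≤0⇒n≡0 i≤0) (sym (n≤0⇒n≡0 j≤0))
    ; edge      = λ ()
    ; chordless = λ _ _ xx → ⊥-elim (irrefl xx)
    ; inside    = λ _ → Px
    }

  prefix : ∀ {P x y k} (c : ChordlessPath P x y k) {i z} → i ≤ k → vertex c i ≡ z
         → ChordlessPath P x z i
  prefix c i≤k vᵢ≡z = record
    { vertex    = vertex c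
    ; start     = start c
    ; end       = vᵢ≡z
    ; injective = λ j≤i j′≤i → injective c (≤-trans j≤i i≤k) (≤-trans j′≤i i≤k)
    ; edge      = λ j<i → edge c (<-≤-trans j<i i≤k)
    ; chordless = λ j≤i j′≤i → chordless c (≤-trans j≤i i≤k) (≤-trans j′≤i i≤k)
    ; inside    = λ j≤i → inside c (≤-trans j≤i i≤k)
    }

  snoc : ∀ {P x y z k} (c : ChordlessPath P x y k) → Adj y z → P z
       → (∀ {i} → i ≤ k → vertex c i ≢ z) → (∀ {i} → i < k → ¬ Adj (vertex c i) z)
       → ChordlessPath P x z (suc k)
  snoc {P} {z = z} {k} c yz Pz distinct nonadjacent = record
    { vertex    = v
    ; start     = trans (v-old z≤n) (start c)
    ; end       = v-new
    ; injective = v-injective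
    ; edge      = v-edge
    ; chordless = v-chordless
    ; inside    = v-inside
    }
    where
    v : ℕ → Fin n
    v i with i ≤? k
    ... | yes _ = vertex c i
    ... | no  _ = z

    v-old : ∀ {i} → i ≤ k → v i ≡ vertex c i
    v-old {i} i≤k with i ≤? k
    ... | yes _   = refl
    ... | no  i≰k = ⊥-elim (i≰k i≤k)

    v-new : v (suc k) ≡ z
    v-new with suc k ≤? k
    ... | yes k<k = ⊥-elim (<-irrefl refl k<k)
    ... | no  _   = refl

    old-or-new : ∀ {i} → i ≤ suc k → i ≤ k ⊎ i ≡ suc k
    old-or-new i≤ = [ inj₁ ∘ m<1+n⇒m≤n , inj₂ ]′ (m≤n⇒m<n∨m≡n i≤)

    v-injective : ∀ {i j} → i ≤ suc k → j ≤ suc k → v i ≡ v j → i ≡ j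
    v-injective i≤ j≤ e with old-or-new i≤ | old-or-new j≤
    ... | inj₁ i≤k  | inj₁ j≤k  =
      injective c i≤k j≤k (trans (sym (v-old i≤k)) (trans e (v-old j≤k)))
    ... | inj₁ i≤k  | inj₂ refl = ⊥-elim (distinct i≤k (trans (sym (v-old i≤k)) (trans e v-new)))
    ... | inj₂ refl | inj₁ j≤k  =
      ⊥-elim (distinct j≤k (trans (sym (v-old j≤k)) (trans (sym e) v-new)))
    ... | inj₂ refl | inj₂ refl = refl

    v-edge : ∀ {i} → i < suc k → Adj (v i) (v (suc i))
    v-edge i<1+k with m≤n⇒m<n∨m≡n (m<1+n⇒m≤n i<1+k)
    ... | inj₁ i<k  = subst₂ Adj (sym (v-old (<⇒≤ i<k))) (sym (v-old i<k)) (edge c i<k)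
    ... | inj₂ refl = subst₂ Adj (sym (trans (v-old ≤-refl) (end c))) (sym v-new) yz

    adjacent-to-new : ∀ {i} → i ≤ k → Adj (vertex c i) z → suc k ≡ suc i
    adjacent-to-new i≤k vᵢz with m≤n⇒m<n∨m≡n i≤k
    ... | inj₁ i<k  = ⊥-elim (nonadjacent i<k vᵢz)
    ... | inj₂ refl = refl

    v-chordless : ∀ {i j} → i ≤ suc k → j ≤ suc k → Adj (v i) (v j) → j ≡ suc i ⊎ i ≡ suc j
    v-chordless i≤ j≤ vᵢvⱼ with old-or-new i≤ | old-or-new j≤
    ... | inj₁ i≤k  | inj₁ j≤k  = chordless c i≤k j≤k (subst₂ Adj (v-old i≤k) (v-old j≤k) vᵢvⱼ)
    ... | inj₁ i≤k  | inj₂ refl =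
      inj₁ (adjacent-to-new i≤k (subst₂ Adj (v-old i≤k) v-new vᵢvⱼ))
    ... | inj₂ refl | inj₁ j≤k  =
      inj₂ (adjacent-to-new j≤k (subst₂ Adj (v-old j≤k) v-new (Adj-sym vᵢvⱼ)))
    ... | inj₂ refl | inj₂ refl = ⊥-elim (irrefl vᵢvⱼ)

    v-inside : ∀ {i} → i ≤ suc k → P (v i)
    v-inside i≤ with old-or-new i≤
    ... | inj₁ i≤k  = subst P (sym (v-old i≤k)) (inside c i≤k)
    ... | inj₂ refl = subst P (sym v-new) Pz

  module _ (Adj? : Decidable Adj) where

    -- Cut the path at its first vertex that equals or is adjacent to z, then attach z.
    extend : ∀ {P x y z k} → ChordlessPath P x y k → Adj y z → P z → ∃[ k′ ] ChordlessPath P x z k′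
    extend {z = z} c yz Pz
      with least (λ i → (vertex c i ≟ z) ⊎-dec Adj? (vertex c i) z)
                 (inj₂ (subst (λ w → Adj w z) (sym (end c)) yz))
    ... | i , i≤k , inj₁ vᵢ≡z , _       = i , prefix c i≤k vᵢ≡z
    ... | i , i≤k , inj₂ vᵢz  , earlier =
      suc i , snoc (prefix c i≤k refl) vᵢz Pz distinct (λ j<i → earlier j<i ∘ inj₂)
      where
      distinct : ∀ {j} → j ≤ i → vertex c j ≢ z
      distinct j≤i with m≤n⇒m<n∨m≡n j≤i
      ... | inj₁ j<i  = earlier j<i ∘ inj₁
      ... | inj₂ refl = λ vᵢ≡z → irrefl (subst (Adj _) (sym vᵢ≡z) vᵢz)

    chordlessPath : ∀ {P x y} → WalkIn P x y → ∃[ k ] ChordlessPath P x y k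
    chordlessPath (stay Px)      = 0 , singleton Px
    chordlessPath (step w yz Pz) = extend (proj₂ (chordlessPath w)) yz Pz

    Convex⇒WalkIn : ∀ {C x y} → Connected G → Convex G C → C x → C y → WalkIn C x y
    Convex⇒WalkIn {x = x} {y} connected convex Cx Cy with connected x y
    ... | k , p , walk with chordlessPath (IsWalk⇒WalkIn {P = U} k p walk _)
    ...   | _ , c = ChordlessPath⇒WalkIn (restrict convex Cx Cy c)

    -- w is the penultimate vertex of a chordless y–b path inside P ∪ {b}, hence in D.
    Convex⇒last-step : ∀ {D P y z b} → Convex G D → D y → D b → ¬ P b
                     → WalkIn P y z → Adj z b → ∃[ w ] P w × D w × Adj w b
    Convex⇒last-step {D} {P} {b = b} convex Dy Db ¬Pb w zb
      with chordlessPath {P = P ∪ᵥ ｛ b ｝} (step (WalkIn-map (λ _ → inj₁) w) zb (inj₂ refl))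
    ... | zero  , c = ⊥-elim (¬Pb (subst P (trans (sym (start c)) (end c)) (WalkIn-source w)))
    ... | suc m , c =
      vertex c m , Pₘ , Convex⇒vertices convex c Dy Db (n≤1+n m)
      , subst (Adj _) (end c) (edge c ≤-refl)
      where
      Pₘ : P (vertex c m)
      Pₘ with inside c (n≤1+n m)
      ... | inj₁ P-vₘ = P-vₘ
      ... | inj₂ vₘ≡b =
        ⊥-elim (<-irrefl (injective c (n≤1+n m) ≤-refl (trans vₘ≡b (sym (end c)))) ≤-refl)

    component-not-across :
      ∀ {A B K X D a b x y} → Connected G → Convex G X → Convex G D → Disjoint X D
      → X a → D b → Adj a b → (A ∪ᵥ B) b
      → IsComponent G A B K → y ∈ K → D y → N[_] G ⟦ K ⟧ x → ¬ X x
    component-not-across {K = K} {X} {D} {a} {b} {x} {y}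
      connected convex-X convex-D X∩D Xa Db ab ABb component yK Dy Nx Xx =
      no-crossing (Convex⇒last-step convex-D Dy Db b∉P y⇝a ab)
      where
      P : VSet n
      P = ⟦ K ⟧ ∪ᵥ X

      outside : ∀ w → w ∈ K → Outside G _ _ w
      outside = proj₁ (proj₂ component)

      y⇝ : N[_] G ⟦ K ⟧ x → WalkIn P y x
      y⇝ (inj₁ xK)                   = WalkIn-map (λ _ → inj₁) (component-walk component yK xK)
      y⇝ (inj₂ (_ , x′ , x′K , xx′)) =
        step (WalkIn-map (λ _ → inj₁) (component-walk component yK x′K)) (Adj-sym xx′) (inj₂ Xx)

      y⇝a : WalkIn P y a
      y⇝a = y⇝ Nx ++ʷ WalkIn-map (λ _ → inj₂) (Convex⇒WalkIn connected convex-X Xx Xa)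

      b∉P : ¬ P b
      b∉P (inj₁ bK) = outside b bK (inj₁ ABb)
      b∉P (inj₂ Xb) = X∩D b Xb Db

      no-crossing : ¬ (∃[ w ] P w × D w × Adj w b)
      no-crossing (w , inj₁ wK , _  , wb) = Outside⇒¬Adj (outside w wK) ABb wb
      no-crossing (w , inj₂ Xw , Dw , _)  = X∩D w Xw Dw

    module _ (connected : Connected G) {A B : VSet n} {H : Subset n} (half : HalfSpace G H)
             {a b : Fin n} (a∈H : a ∈ H) (b∉H : b ∉ H) (ab : Adj a b)
             (ABa : (A ∪ᵥ B) a) (ABb : (A ∪ᵥ B) b) where

      component-same-side : ∀ {K x y} → IsComponent G A B K → y ∈ K → N[_] G ⟦ K ⟧ x
                          → (x ∈ H ⇔ y ∈ H)
      component-same-side component yK Nx = mk⇔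
        (λ x∈H → x∉∁p⇒x∈p λ y∈∁H →
          component-not-across connected (proj₁ half) (HalfSpace⇒Convex-∁ half) H∩∁H
            a∈H (x∉p⇒x∈∁p b∉H) ab ABb component yK y∈∁H Nx x∈H)
        (λ y∈H → x∉∁p⇒x∈p λ x∈∁H →
          component-not-across connected (HalfSpace⇒Convex-∁ half) (proj₁ half) (flip ∘ H∩∁H)
            (x∉p⇒x∈∁p b∉H) a∈H (Adj-sym ab) ABa component yK y∈H Nx x∈∁H)
        where
        H∩∁H : Disjoint ⟦ H ⟧ ⟦ ∁ H ⟧
        H∩∁H _ v∈H v∈∁H = x∈∁p⇒x∉p v∈∁H v∈H

      neighbourhood-same-side : ∀ {K x x′} → IsComponent G A B K
                              → N[_] G ⟦ K ⟧ x → N[_] G ⟦ K ⟧ x′ → (x ∈ H ⇔ x′ ∈ H)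
      neighbourhood-same-side component Nx Nx′ with proj₁ component
      ... | y , yK = ⇔-trans (component-same-side component yK Nx)
                             (⇔-sym (component-same-side component yK Nx′))

      intersecting-same-side : ∀ {k Ss x x′} → IntersectingSeq G A B k Ss
                             → ∀ i → N[_] G ⟦ Ss fzero ⟧ x → N[_] G ⟦ Ss i ⟧ x′ → (x ∈ H ⇔ x′ ∈ H)
      intersecting-same-side (components , _) fzero = neighbourhood-same-side (components fzero)
      intersecting-same-side {zero} _ (fsuc ())
      intersecting-same-side {suc k} (components , meet) (fsuc i) Nx Nx′ with meet fzero
      ... | w , N₀w , N₁w =
        ⇔-trans (neighbourhood-same-side (components fzero) Nx (inj₂ N₀w))
                (intersecting-same-side (components ∘ fsuc , meet ∘ fsuc) i (inj₂ N₁w) Nx′)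

      EquivAB⇒same-side : ∀ {u v} → EquivAB G A B u v → (u ∈ H ⇔ v ∈ H)
      EquivAB⇒same-side (_ , _ , inj₁ refl) = ⇔-refl
      EquivAB⇒same-side (_ , _ , inj₂ (_ , _ , seq , (i , Nu) , (j , Nv)))
        with proj₁ (proj₁ seq fzero)
      ... | y , yK = ⇔-trans (⇔-sym (intersecting-same-side seq i (inj₁ yK) Nu))
                             (intersecting-same-side seq j (inj₁ yK) Nv)

proposition23 : ∀ {n : ℕ} (G : Graph n) (A B : Subset n) (u v : Fin n)
    → Connected G
    → Disjoint ⟦ A ⟧ ⟦ B ⟧
    → Linked G ⟦ A ⟧ ⟦ B ⟧
    → Saturated G ⟦ A ⟧ ⟦ B ⟧
    → ¬ ⟦ A ∪ B ⟧ u
    → ¬ ⟦ A ∪ B ⟧ v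
    → MFS G ⟦ A ⟧ ⟦ B ⟧ (⁅ u ⁆ ∪ ⁅ v ⁆)
    → EquivAB G ⟦ A ⟧ ⟦ B ⟧ u v
    → ¬ Separable G ⟦ A ⟧ ⟦ B ⟧
proposition23 G A B u v connected _ (a , b , a∈A , b∈B , ab) _ _ _ (forbidden , _) u≡v
              (H , half , A⊆H , B∌H) =
  ¬¬-decidable (Graph.Adj G) λ Adj? →
    one-side-not-forbidden G half A⊆H B∌H
      (same-side⇒pair-on-one-side
        (EquivAB⇒same-side G Adj? connected half (A⊆H a a∈A) (B∌H b b∈B) ab
                           (inj₁ a∈A) (inj₂ b∈B) u≡v))
      forbidden
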